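{- Let $\mathcal A\subseteq\mathbb N$, $L$ an environment and $T$ a term. If $L\vdash_{\mathcal A}T$, then there exists an arity $A$ such that $L\vdash T::A$.
   Context: Fix a nonempty set $\Sigma$ of sorts with decidable equality, an arbitrary function $\mathrm{next}:\Sigma\to\Sigma$, and a countably infinite set of variables. Terms and environments: $T,U,V,W ::= \star s \mid x \mid \mathrm{app}(V,T) \mid \lambda x{:}W.\,T \mid \mathrm{def}(x{=}V).\,T \mid \mathrm{cast}(U,T)$ ($s\in\Sigma$) and $L,K ::= \emptyset \mid K,x{:}W \mid K,x{=}V$. $\mathrm{app}(V,T)$ applies $T$ to $V$; $\lambda x{:}W.\,T$ (de Bruijn's abstraction) and $\mathrm{def}(x{=}V).\,T$ (local definition) bind $x$ in $T$; $\mathrm{cast}(U,T)$ annotates $T$ with expected type $U$; entries $x{:}W$ (declaration) and $x{=}V$ (definition) bind $x$. Terms are modulo renaming of bound variables, with bound variables distinct from each other and from free ones. Write $\mathsf{B}x[V]$ for either $\lambda x{:}V$ or $\mathrm{def}(x{=}V)$ and correspondingly $L,x[V]$ for $L,x{:}V$ resp. $L,x{=}V$. One step of bound rt-reduction $L\vdash T_1\to^nT_2$ is the smallest relation closed under: $L\vdash\mathrm{app}(V,\lambda x{:}W.\,T)\to^0\mathrm{def}(x{=}\mathrm{cast}(W,V)).\,T$; $K,x{=}V\vdash x\to^0V$; $L\vdash\mathrm{def}(x{=}V).\,T\to^0T$ if $x$ not free in $T$; $L\vdash\mathrm{app}(V,\mathrm{def}(x{=}W).\,T)\to^0\mathrm{def}(x{=}W).\,\mathrm{app}(V,T)$;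 $L\vdash\mathrm{cast}(U,T)\to^0T$; $L\vdash\star s\to^1\star\,\mathrm{next}(s)$; $K,x{:}W\vdash x\to^1W$; $L\vdash\mathrm{cast}(U,T)\to^1U$; if $K\vdash x\to^nT$, $y\neq x$, $y$ not free in $T$ then $K,y[V]\vdash x\to^nT$; if $L\vdash V_1\to^0V_2$ then $L\vdash\mathrm{app}(V_1,T)\to^0\mathrm{app}(V_2,T)$; if $L\vdash T_1\to^nT_2$ then $L\vdash\mathrm{app}(V,T_1)\to^n\mathrm{app}(V,T_2)$; if $L\vdash V_1\to^0V_2$ then $L\vdash\mathsf Bx[V_1].\,T\to^0\mathsf Bx[V_2].\,T$; if $L,x[V]\vdash T_1\to^nT_2$ then $L\vdash\mathsf Bx[V].\,T_1\to^n\mathsf Bx[V].\,T_2$; if $L\vdash U_1\to^0U_2$ then $L\vdash\mathrm{cast}(U_1,T)\to^0\mathrm{cast}(U_2,T)$; if $L\vdash T_1\to^0T_2$ then $L\vdash\mathrm{cast}(U,T_1)\to^0\mathrm{cast}(U,T_2)$; if $L\vdash U_1\to^1U_2$ and $L\vdash T_1\to^1T_2$ then $L\vdash\mathrm{cast}(U_1,T_1)\to^1\mathrm{cast}(U_2,T_2)$. The relation $L\vdash T_1\to^{*n}T_2$ is the smallest with $L\vdash T\to^{*0}T$, containing single steps, and with $L\vdash T_1\to^{*n_1}T$, $L\vdash T\to^{*n_2}T_2$ implying $L\vdash T_1\to^{*n_1+n_2}T_2$. Validity $L\vdash_{\mathcal A}T$ (for $\mathcal A\subseteq\mathbb N$)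 is the smallest predicate closed under: $L\vdash_{\mathcal A}\star s$; if $K\vdash_{\mathcal A}V$ then $K,x[V]\vdash_{\mathcal A}x$; if $K\vdash_{\mathcal A}x$ and $y\neq x$ then $K,y[V]\vdash_{\mathcal A}x$; if $L\vdash_{\mathcal A}V$ and $L,x[V]\vdash_{\mathcal A}T$ then $L\vdash_{\mathcal A}\mathsf Bx[V].\,T$; if $L\vdash_{\mathcal A}U$, $L\vdash_{\mathcal A}T$ and some $U_0$ satisfies $L\vdash T\to^{*1}U_0$ and $L\vdash U\to^{*0}U_0$, then $L\vdash_{\mathcal A}\mathrm{cast}(U,T)$; if $L\vdash_{\mathcal A}V$, $L\vdash_{\mathcal A}T$ and there are $n\in\mathcal A$ and $x,W_0,U_0$ with $L\vdash T\to^{*n}\lambda x{:}W_0.\,U_0$ and $L\vdash V\to^{*1}W_0$, then $L\vdash_{\mathcal A}\mathrm{app}(V,T)$. Arities are $A,B::=\circ\mid B\Rightarrow A$. Arity assignment $L\vdash T::A$ is the smallest relation closed under: $L\vdash\star s::\circ$; if $K\vdash V::A$ then $K,x[V]\vdash x::A$; if $K\vdash x::A$ and $y\neq x$ then $K,y[V]\vdash x::A$; if $L\vdash W::B$ and $L,x{:}W\vdash T::A$ then $L\vdash\lambda x{:}W.\,T::B\Rightarrow A$; if $L\vdash V::B$ and $L,x{=}V\vdash T::A$ then $L\vdash\mathrm{def}(x{=}V).\,T::A$; if $L\vdash V::B$ and $L\vdash T::B\Rightarrow A$ then $L\vdash\mathrm{app}(V,T)::A$; if $L\vdash U::A$ and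 $L\vdash T::A$ then $L\vdash\mathrm{cast}(U,T)::A$. -}

module Defs where

-- Terms are represented with de Bruijn indices (this realises "terms modulo
-- renaming of bound variables" and the variable conventions of the paper).

open import Data.Nat using (ℕ; zero; suc; _+_; _<_)
open import Data.Nat using () renaming (_<ᵇ_ to _<ᵇ_)
open import Data.Bool using (if_then_else_)
open import Relation.Unary using (Pred)
open import Level using (0ℓ)

data Bind : Set where
  abst : Bind
  abbr : Bind

data Term (S : Set) : Set where
  sort : S → Term S
  var  : ℕ → Term S
  app  : Term S → Term S → Term S            -- app(V,T) : T applied to V
  bind : Bind → Term S → Term S → Term S
  cast : Term S → Term S → Term S

lam : {S : Set} → Term S → Term S → Term S
lam = bind abst

def : {S : Set} → Term S → Term S → Term S
def = bind abbr

data Env (S : Set) : Set where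
  ∅     : Env S
  _,[_]_ : Env S → Bind → Term S → Env S

lift : {S : Set} → ℕ → Term S → Term S
lift c (sort s)     = sort s
lift c (var i)      = if i <ᵇ c then var i else var (suc i)
lift c (app V T)    = app (lift c V) (lift c T)
lift c (bind b V T) = bind b (lift c V) (lift (suc c) T)
lift c (cast U T)   = cast (lift c U) (lift c T)

-- ↑ T : T weakened under one more binder ("y not free in ↑T")
↑ : {S : Set} → Term S → Term S
↑ = lift 0

module _ {S : Set} (next : S → S) where

  data Step : Env S → ℕ → Term S → Term S → Set where
    β     : ∀ {L V W T} → Step L 0 (app V (lam W T)) (def (cast W V) T)
    δ     : ∀ {K V} → Step (K ,[ abbr ] V) 0 (var 0) (↑ V)
    ζ     : ∀ {L V T} → Step L 0 (def V (↑ T)) T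
    θ     : ∀ {L V W T} → Step L 0 (app V (def W T)) (def W (app (↑ V) T))
    ε     : ∀ {L U T} → Step L 0 (cast U T) T
    srt   : ∀ {L s} → Step L 1 (sort s) (sort (next s))
    ldec  : ∀ {K W} → Step (K ,[ abst ] W) 1 (var 0) (↑ W)
    ee    : ∀ {L U T} → Step L 1 (cast U T) U
    lref  : ∀ {K b V i n T} → Step K n (var i) T →
            Step (K ,[ b ] V) n (var (suc i)) (↑ T)
    appV  : ∀ {L V₁ V₂ T} → Step L 0 V₁ V₂ → Step L 0 (app V₁ T) (app V₂ T)
    appT  : ∀ {L V T₁ T₂ n} → Step L n T₁ T₂ → Step L n (app V T₁) (app V T₂)
    bindV : ∀ {L b V₁ V₂ T} → Step L 0 V₁ V₂ → Step L 0 (bind b V₁ T) (bind b V₂ T)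
    bindT : ∀ {L b V T₁ T₂ n} → Step (L ,[ b ] V) n T₁ T₂ →
            Step L n (bind b V T₁) (bind b V T₂)
    castU : ∀ {L U₁ U₂ T} → Step L 0 U₁ U₂ → Step L 0 (cast U₁ T) (cast U₂ T)
    castT : ∀ {L U T₁ T₂} → Step L 0 T₁ T₂ → Step L 0 (cast U T₁) (cast U T₂)
    cast1 : ∀ {L U₁ U₂ T₁ T₂} → Step L 1 U₁ U₂ → Step L 1 T₁ T₂ →
            Step L 1 (cast U₁ T₁) (cast U₂ T₂)

  data Steps : Env S → ℕ → Term S → Term S → Set where
    refl* : ∀ {L T} → Steps L 0 T T
    step* : ∀ {L n T₁ T₂} → Step L n T₁ T₂ → Steps L n T₁ T₂
    trans* : ∀ {L n₁ n₂ T₁ T T₂} → Steps L n₁ T₁ T → Steps L n₂ T T₂ →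
             Steps L (n₁ + n₂) T₁ T₂

  data Valid (𝒜 : Pred ℕ 0ℓ) : Env S → Term S → Set where
    vsort : ∀ {L s} → Valid 𝒜 L (sort s)
    vzero : ∀ {K b V} → Valid 𝒜 K V → Valid 𝒜 (K ,[ b ] V) (var 0)
    vsucc : ∀ {K b V i} → Valid 𝒜 K (var i) → Valid 𝒜 (K ,[ b ] V) (var (suc i))
    vbind : ∀ {L b V T} → Valid 𝒜 L V → Valid 𝒜 (L ,[ b ] V) T →
            Valid 𝒜 L (bind b V T)
    vcast : ∀ {L U T U₀} → Valid 𝒜 L U → Valid 𝒜 L T →
            Steps L 1 T U₀ → Steps L 0 U U₀ → Valid 𝒜 L (cast U T)
    vapp  : ∀ {L V T n W₀ U₀} → Valid 𝒜 L V → Valid 𝒜 L T → 𝒜 n →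
            Steps L n T (lam W₀ U₀) → Steps L 1 V W₀ → Valid 𝒜 L (app V T)

data Arity : Set where
  ∘    : Arity
  _⇒_ : Arity → Arity → Arity

data HasArity {S : Set} : Env S → Term S → Arity → Set where
  asort : ∀ {L s} → HasArity L (sort s) ∘
  azero : ∀ {K b V A} → HasArity K V A → HasArity (K ,[ b ] V) (var 0) A
  asucc : ∀ {K b V i A} → HasArity K (var i) A →
          HasArity (K ,[ b ] V) (var (suc i)) A
  alam  : ∀ {L W T A B} → HasArity L W B → HasArity (L ,[ abst ] W) T A →
          HasArity L (lam W T) (B ⇒ A)
  adef  : ∀ {L V T A B} → HasArity L V B → HasArity (L ,[ abbr ] V) T A →
          HasArity L (def V T) A
  aapp  : ∀ {L V T A B} → HasArity L V B → HasArity L T (B ⇒ A) →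
          HasArity L (app V T) A
  acast : ∀ {L U T A} → HasArity L U A → HasArity L T A →
          HasArity L (cast U T) A

module Submission where

-- The binder and variable rules of validity mirror those
-- of arity assignment exactly.  The two side conditions of validity
-- (in cast and app) relate terms through rt-reduction, so the key fact is
-- subject reduction: an rt-reduction step preserves arities.  Because an
-- arity is unique, the two sides of each side condition then receive the
-- same arity, which is what the cast and app rules of arity assignment need.
--
-- Subject reduction rests on three structural facts about arity assignment:
--   * uniqueness of arities;
--   * transport along environments whose entries have the same arities
--     (needed for β, where x:W becomes x=cast(W,V), and for reduction
--     inside a binder's type);
--   * weakening and strengthening with respect to de Bruijn lifting
--     (needed for δ, the λ-declaration step, lref, θ and ζ).

open import Defs
open import Data.Nat using (ℕ; zero; suc)
open import Data.Nat using () renaming (_<ᵇ_ to _<ᵇ_)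
open import Data.Bool using (true; false)
open import Data.Product using (∃; _,_)
open import Relation.Binary.Definitions using (DecidableEquality)
open import Relation.Binary.PropositionalEquality using (_≡_; refl; subst)
open import Relation.Unary using (Pred)
open import Level using (0ℓ)

module _ {S : Set} where

  arity-unique : ∀ {L : Env S} {T A A′} → HasArity L T A → HasArity L T A′ → A ≡ A′
  arity-unique asort asort = refl
  arity-unique (azero h) (azero h′) = arity-unique h h′
  arity-unique (asucc h) (asucc h′) = arity-unique h h′
  arity-unique (alam hW hT) (alam hW′ hT′) with arity-unique hW hW′ | arity-unique hT hT′
  ... | refl | refl = refl
  arity-unique (adef hV hT) (adef hV′ hT′) with arity-unique hV hV′
  ... | refl = arity-unique hT hT′
  arity-unique (aapp hV hT) (aapp hV′ hT′) with arity-unique hV hV′ | arity-unique hT hT′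
  ... | refl | refl = refl
  arity-unique (acast hU _) (acast hU′ _) = arity-unique hU hU′

  data EnvSim : Env S → Env S → Set where
    nil  : EnvSim ∅ ∅
    keep : ∀ {L K b V} → EnvSim L K → EnvSim (L ,[ b ] V) (K ,[ b ] V)
    swap : ∀ {L K b b′ V V′} → EnvSim L K →
           (∀ {A} → HasArity L V A → HasArity K V′ A) →
           EnvSim (L ,[ b ] V) (K ,[ b′ ] V′)

  envSim-refl : ∀ {L} → EnvSim L L
  envSim-refl {∅} = nil
  envSim-refl {L ,[ b ] V} = keep envSim-refl

  replace-top : ∀ {L b b′ V V′} → (∀ {A} → HasArity L V A → HasArity L V′ A) →
                EnvSim (L ,[ b ] V) (L ,[ b′ ] V′)
  replace-top = swap envSim-refl

  -- Arity assignment only sees the arities of environment entries.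
  transport : ∀ {L K T A} → EnvSim L K → HasArity L T A → HasArity K T A
  transport sim asort = asort
  transport (keep sim) (azero h) = azero (transport sim h)
  transport (swap sim f) (azero h) = azero (f h)
  transport (keep sim) (asucc h) = asucc (transport sim h)
  transport (swap sim f) (asucc h) = asucc (transport sim h)
  transport sim (alam hW hT) = alam (transport sim hW) (transport (keep sim) hT)
  transport sim (adef hV hT) = adef (transport sim hV) (transport (keep sim) hT)
  transport sim (aapp hV hT) = aapp (transport sim hV) (transport sim hT)
  transport sim (acast hU hT) = acast (transport sim hU) (transport sim hT)

  data Insertion : ℕ → Env S → Env S → Set where
    here  : ∀ {L b V} → Insertion 0 L (L ,[ b ] V)
    there : ∀ {c L L′ b V} → Insertion c L L′ →
            Insertion (suc c) (L ,[ b ] V) (L′ ,[ b ] lift c V)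

  -- lift (suc c) (var (suc i)) is var (suc j) where var j = lift c (var i);
  -- the computation only unfolds after deciding i <ᵇ c.
  asucc-lift : ∀ {K : Env S} {b W A} c i → HasArity K (lift c (var i)) A →
               HasArity (K ,[ b ] W) (lift (suc c) (var (suc i))) A
  asucc-lift c i h with i <ᵇ c
  ... | true  = asucc h
  ... | false = asucc h

  weaken : ∀ {c L L′ T A} → Insertion c L L′ → HasArity L T A → HasArity L′ (lift c T) A
  weaken ins asort = asort
  weaken here (azero h) = asucc (azero h)
  weaken (there ins) (azero h) = azero (weaken ins h)
  weaken here (asucc h) = asucc (asucc h)
  weaken {suc c} (there ins) (asucc {i = i} h) = asucc-lift c i (weaken ins h)
  weaken ins (alam hW hT) = alam (weaken ins hW) (weaken (there ins) hT)
  weaken ins (adef hV hT) = adef (weaken ins hV) (weaken (there ins) hT)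
  weaken ins (aapp hV hT) = aapp (weaken ins hV) (weaken ins hT)
  weaken ins (acast hU hT) = acast (weaken ins hU) (weaken ins hT)

  lift-var-below : ∀ c i → (i <ᵇ c) ≡ true → lift {S} c (var i) ≡ var i
  lift-var-below c i below rewrite below = refl

  lift-var-above : ∀ c i → (i <ᵇ c) ≡ false → lift {S} c (var i) ≡ var (suc i)
  lift-var-above c i above rewrite above = refl

  -- The lifted term is given up to an equation so
  -- that the derivation can be analysed by matching on T.
  strengthen : ∀ {c L L′ A} → Insertion c L L′ → (T : Term S) {T′ : Term S} →
               lift c T ≡ T′ → HasArity L′ T′ A → HasArity L T A
  strengthen ins (sort s) refl asort = asort
  strengthen here (var i) refl (asucc h) = h
  strengthen (there ins) (var zero) refl (azero h) = azero (strengthen ins _ refl h)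
  strengthen {suc c} (there ins) (var (suc i)) eq h with i <ᵇ c in e
  strengthen {suc c} (there ins) (var (suc i)) refl (asucc h) | true =
    asucc (strengthen ins (var i) (lift-var-below c i e) h)
  strengthen {suc c} (there ins) (var (suc i)) refl (asucc h) | false =
    asucc (strengthen ins (var i) (lift-var-above c i e) h)
  strengthen ins (app V T) refl (aapp hV hT) =
    aapp (strengthen ins V refl hV) (strengthen ins T refl hT)
  strengthen ins (bind abst W T) refl (alam hW hT) =
    alam (strengthen ins W refl hW) (strengthen (there ins) T refl hT)
  strengthen ins (bind abbr V T) refl (adef hV hT) =
    adef (strengthen ins V refl hV) (strengthen (there ins) T refl hT)
  strengthen ins (cast U T) refl (acast hU hT) =
    acast (strengthen ins U refl hU) (strengthen ins T refl hT)

  module _ (next : S → S) where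

    -- Subject reduction for one rt-step.  In β the declaration x:W becomes
    -- the definition x = cast(W,V), which has the arity of W since V and W
    -- share it (uniqueness).
    step-preserves : ∀ {L n T₁ T₂ A} → Step next L n T₁ T₂ →
                     HasArity L T₁ A → HasArity L T₂ A
    step-preserves β (aapp hV (alam hW hT)) =
      adef (acast hW hV) (transport (replace-top castW) hT)
      where
        castW : ∀ {B} → HasArity _ _ B → HasArity _ _ B
        castW hW′ = acast hW′ (subst (HasArity _ _) (arity-unique hW hW′) hV)
    step-preserves δ (azero h) = weaken here h
    step-preserves (ζ {T = T}) (adef _ hT) = strengthen here T refl hT
    step-preserves θ (aapp hV (adef hW hT)) = adef hW (aapp (weaken here hV) hT)
    step-preserves ε (acast _ hT) = hT
    step-preserves srt asort = asort
    step-preserves ldec (azero h) = weaken here h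
    step-preserves ee (acast hU _) = hU
    step-preserves (lref s) (asucc h) = weaken here (step-preserves s h)
    step-preserves (appV s) (aapp hV hT) = aapp (step-preserves s hV) hT
    step-preserves (appT s) (aapp hV hT) = aapp hV (step-preserves s hT)
    step-preserves (bindV s) (alam hW hT) =
      alam (step-preserves s hW) (transport (replace-top (step-preserves s)) hT)
    step-preserves (bindV s) (adef hV hT) =
      adef (step-preserves s hV) (transport (replace-top (step-preserves s)) hT)
    step-preserves (bindT s) (alam hW hT) = alam hW (step-preserves s hT)
    step-preserves (bindT s) (adef hV hT) = adef hV (step-preserves s hT)
    step-preserves (castU s) (acast hU hT) = acast (step-preserves s hU) hT
    step-preserves (castT s) (acast hU hT) = acast hU (step-preserves s hT)
    step-preserves (cast1 sU sT) (acast hU hT) =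
      acast (step-preserves sU hU) (step-preserves sT hT)

    steps-preserves : ∀ {L n T₁ T₂ A} → Steps next L n T₁ T₂ →
                      HasArity L T₁ A → HasArity L T₂ A
    steps-preserves refl* h = h
    steps-preserves (step* s) h = step-preserves s h
    steps-preserves (trans* s₁ s₂) h = steps-preserves s₂ (steps-preserves s₁ h)

    common-reduct-arity : ∀ {L m n T₁ T₂ T A₁ A₂} →
      Steps next L m T₁ T → Steps next L n T₂ T →
      HasArity L T₁ A₁ → HasArity L T₂ A₂ → A₁ ≡ A₂
    common-reduct-arity s₁ s₂ h₁ h₂ =
      arity-unique (steps-preserves s₁ h₁) (steps-preserves s₂ h₂)

    -- For app(V,T): T reduces to some λx:W₀.U₀, which therefore has an
    -- arity B ⇒ A with B the arity of W₀, and V reduces to W₀ as well.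
    valid⇒arity : ∀ {𝒜 : Pred ℕ 0ℓ} {L T} → Valid next 𝒜 L T → ∃ λ A → HasArity L T A
    valid⇒arity vsort = ∘ , asort
    valid⇒arity (vzero vV) with valid⇒arity vV
    ... | A , hV = A , azero hV
    valid⇒arity (vsucc vx) with valid⇒arity vx
    ... | A , hx = A , asucc hx
    valid⇒arity (vbind {b = abst} vW vT) with valid⇒arity vW | valid⇒arity vT
    ... | B , hW | A , hT = B ⇒ A , alam hW hT
    valid⇒arity (vbind {b = abbr} vV vT) with valid⇒arity vV | valid⇒arity vT
    ... | _ , hV | A , hT = A , adef hV hT
    valid⇒arity (vcast vU vT sT sU) with valid⇒arity vU | valid⇒arity vT
    ... | A , hU | _ , hT with common-reduct-arity sU sT hU hT
    ... | refl = A , acast hU hT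
    valid⇒arity (vapp vV vT _ sT sV) with valid⇒arity vV | valid⇒arity vT
    ... | _ , hV | _ , hT with steps-preserves sT hT
    ... | alam {A = A} hW₀ _ with arity-unique (steps-preserves sV hV) hW₀
    ... | refl = A , aapp hV hT

theorem4p4 : (S : Set) → DecidableEquality S → S → (next : S → S) →
    (𝒜 : Pred ℕ 0ℓ) (L : Env S) (T : Term S) →
    Valid next 𝒜 L T → ∃ λ A → HasArity L T A
theorem4p4 S _ _ next 𝒜 L T valid = valid⇒arity next valid
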